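{- Let $a\ge 1$, let $\vec n=(n_0,\ldots,n_x)$ be a finite sequence of positive integers, let $\vec T$ be a system of trees which is $2^{a-1}\vec n$-good from some sequence of strings $\vec\alpha=(\alpha_0,\ldots,\alpha_x)$, and let $P_1,\ldots,P_a$ be sets of $(x+1)$-tuples of strings such that every element of $\vec T$ lies in $\bigcup_i P_i$. Then for some $i$, $\vec T$ has a subsystem which is $\vec n$-good from $\vec\alpha$ for $P_i$.
   Context: A tree is a finite set of pairwise incomparable strings in $\omega^{<\omega}$. A nonempty tree $T$ is $a$-good from $\sigma$ if every $\tau\in T$ extends $\sigma$ and for each string $\tau$ with $\sigma\subseteq\tau\subsetneq\rho$ for some $\rho\in T$, at least $a$ immediate successors $\tau*k$ of $\tau$ are initial segments of elements of $T$. A system of trees $\vec T_x=(T_0,\ldots,T_x)$ consists of a tree $T_0$ and recursively, for each $k<x$ and each $\sigma_k\in T_k(\vec\sigma_{k-1})$, a tree $T_{k+1}(\vec\sigma_k)$, where $\vec\sigma_k=(\sigma_0,\ldots,\sigma_k)$ and $T_0(\vec\sigma_{ -1})=T_0$. Its elements are the tuples $\vec\sigma_x$ with $\sigma_k\in T_k(\vec\sigma_{k-1})$ for all $k\le x$. It is $\vec n_x$-good from $\vec\alpha_x$ if for every $k\le x$ and every element $\vec\beta_{k-1}$ of $(T_0,\ldots,T_{k-1})$, $T_k(\vec\beta_{k-1})$ is $n_k$-good from $\alpha_k$. A system is for $P$ if all its elements lie in $P$; a subsystem is a system all of whose elements are elements of $\vec T$. $2^{a-1}\vec n$ denotes $(2^{a-1}n_0,\ldots,2^{a-1}n_x)$.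 -}

module Defs where

open import Data.Nat using (ℕ; zero; suc; _≥_)
open import Data.List using (List; []; _∷_; _++_; [_]; length)
open import Data.List.Membership.Propositional using (_∈_)
open import Data.List.Relation.Unary.All using (All)
open import Data.List.Relation.Unary.Unique.Propositional using (Unique)
open import Data.Vec using (Vec; []; _∷_)
open import Data.Product using (Σ; ∃; _×_; _,_)
open import Data.Unit using (⊤)
open import Relation.Binary.PropositionalEquality using (_≡_; _≢_)

Str : Set
Str = List ℕ

_⊑_ : Str → Str → Set
σ ⊑ τ = ∃ λ ρ → σ ++ ρ ≡ τ

_⊏_ : Str → Str → Set
σ ⊏ τ = σ ⊑ τ × σ ≢ τ

-- A finite set of strings is represented by a list (repetitions irrelevant).
Tree : Set
Tree = List Str

IsTree : Tree → Set
IsTree T = ∀ {ρ τ} → ρ ∈ T → τ ∈ T → ρ ⊑ τ → ρ ≡ τ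

Good : ℕ → Str → Tree → Set
Good a σ T =
  (∃ λ ρ → ρ ∈ T)
  × (∀ {τ} → τ ∈ T → σ ⊑ τ)
  × (∀ τ ρ → ρ ∈ T → σ ⊑ τ → τ ⊏ ρ →
       Σ (List ℕ) λ ks → length ks ≥ a × Unique ks
         × All (λ k → ∃ λ ρ′ → ρ′ ∈ T × (τ ++ [ k ]) ⊑ ρ′) ks)

-- A system of trees: S (σ₀ ∷ … ∷ σ_{k-1} ∷ []) is the tree T_k(σ₀,…,σ_{k-1}).
-- Only the values at elements (prefixes of elements) matter.
System : Set
System = List Str → Tree

ElemFrom : System → List Str → (m : ℕ) → Vec Str m → Set
ElemFrom S pre zero [] = ⊤
ElemFrom S pre (suc m) (σ ∷ σs) = σ ∈ S pre × ElemFrom S (pre ++ [ σ ]) m σs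

Element : (x : ℕ) → System → Vec Str (suc x) → Set
Element x S = ElemFrom S [] (suc x)

TreesFrom : System → List Str → ℕ → Set
TreesFrom S pre zero = ⊤
TreesFrom S pre (suc m) = IsTree (S pre) × (∀ {σ} → σ ∈ S pre → TreesFrom S (pre ++ [ σ ]) m)

IsSystemOfTrees : (x : ℕ) → System → Set
IsSystemOfTrees x S = TreesFrom S [] (suc x)

GoodFromAux : System → List Str → (m : ℕ) → Vec ℕ m → Vec Str m → Set
GoodFromAux S pre zero [] [] = ⊤
GoodFromAux S pre (suc m) (n ∷ ns) (α ∷ αs) =
  Good n α (S pre) × (∀ {σ} → σ ∈ S pre → GoodFromAux S (pre ++ [ σ ]) m ns αs)

GoodSys : (x : ℕ) → System → Vec ℕ (suc x) → Vec Str (suc x) → Set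
GoodSys x S = GoodFromAux S [] (suc x)

Subsystem : (x : ℕ) → System → System → Set
Subsystem x S′ S = IsSystemOfTrees x S′ × (∀ v → Element x S′ v → Element x S v)

SystemFor : (x : ℕ) → System → (Vec Str (suc x) → Set) → Set
SystemFor x S P = ∀ v → Element x S v → P v

module Submission where

-- Colour every element of the system by the index i of a set P_i containing it;
-- with a = b + 1 colours, the proof in fact needs only that the system is
-- ((b+1)·n⃗)-good, and b + 1 ≤ 2^b.
--
-- A nonempty branch of an N-good tree is N-good, and n-good
--    trees above n distinct successors of α glue to a tree n-good from α.  By
--    induction on the height, an N-good tree, N ≥ (b+1)·n, whose elements are
--    coloured with b+1 colours has a monochromatic n-good subtree: each root
--    successor carries one, and n of these share a colour.
-- 4. Systems.  Grafting subsystems S_ρ above the elements ρ of a tree V yields a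
--    system whose properties are inherited from V and the S_ρ.
-- 5. Induction on the number of levels: every ρ in the top tree carries, by
--    induction, a monochromatic good subsystem of some colour i_ρ; the single
--    tree lemma for the colouring ρ ↦ i_ρ selects the new top tree.

open import Defs
open import Data.Nat using (ℕ; suc; _≥_; _>_; _*_; _^_; _∸_)
open import Data.Fin using (Fin)
open import Data.Vec using (Vec; map)
open import Data.Vec.Relation.Unary.All using (All)
open import Data.Product using (Σ; ∃; _×_)

open import Data.Nat using (zero; _+_; _≤_; _<_; _⊔_; z≤n; s≤s; _≤?_)
import Data.Nat as ℕ
open import Data.Nat.Properties
open import Data.Fin using () renaming (zero to fzero; suc to fsuc)
import Data.Fin as Fin
open import Data.List using (List; []; _∷_; _++_; [_]; length; filter; concatMap; drop)
open import Data.List.Properties using (++-identityʳ; ++-assoc; ∷-injective; ≡-dec; length-++)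
open import Data.List.Membership.Propositional using (_∈_; find; lose)
open import Data.List.Membership.Propositional.Properties
  using (∈-filter⁺; ∈-filter⁻; ∈-concatMap⁺; ∈-concatMap⁻)
import Data.List.Membership.DecPropositional as DecMembership
open import Data.List.Relation.Binary.Subset.Propositional using (_⊆_)
open import Data.List.Relation.Binary.Subset.Propositional.Properties using (filter-⊆; ⊆-refl; ⊆-trans)
open import Data.List.Relation.Unary.Any using (here; there)
import Data.List.Relation.Unary.All as ListAll
open import Data.List.Relation.Unary.All.Properties using (all-filter)
open import Data.List.Relation.Unary.All.Properties.Core using (¬All⇒Any¬)
open import Data.List.Relation.Unary.Unique.Propositional using (Unique)
import Data.List.Relation.Unary.Unique.Propositional.Properties as Unique
open import Data.Vec using (_∷_; [])
open import Data.Vec.Relation.Unary.All using (_∷_)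
open import Data.Product using (_,_; proj₁; proj₂)
open import Data.Sum using (_⊎_; inj₁; inj₂)
open import Data.Unit using (tt)
open import Function using (_∘_)
open import Relation.Nullary using (Dec; yes; no; ¬?; contradiction)
open import Relation.Unary using (Decidable)
open import Relation.Binary.Definitions using (DecidableEquality)
open import Relation.Binary.PropositionalEquality
  using (_≡_; _≢_; refl; sym; trans; cong; subst; ≢-sym)

⊑-refl : ∀ σ → σ ⊑ σ
⊑-refl σ = [] , ++-identityʳ σ

⊑-trans : ∀ {σ τ ρ} → σ ⊑ τ → τ ⊑ ρ → σ ⊑ ρ
⊑-trans {σ} (r , refl) (r′ , refl) = r ++ r′ , sym (++-assoc σ r r′)

⊑-++ : ∀ σ r → σ ⊑ (σ ++ r)
⊑-++ σ r = r , refl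

length-⊑ : ∀ {σ τ} → σ ⊑ τ → length σ ≤ length τ
length-⊑ {σ} (r , refl) = subst (length σ ≤_) (sym (length-++ σ)) (m≤m+n (length σ) (length r))

⊑-length-≡ : ∀ {σ τ} → σ ⊑ τ → length τ ≤ length σ → σ ≡ τ
⊑-length-≡ {σ} ([] , refl) _ = sym (++-identityʳ σ)
⊑-length-≡ {σ} (k ∷ r , refl) long =
  contradiction (subst (_≤ length σ) (length-++ σ) long) (m+1+n≰m (length σ))

⊑-antisym : ∀ {σ τ} → σ ⊑ τ → τ ⊑ σ → σ ≡ τ
⊑-antisym σ⊑τ τ⊑σ = ⊑-length-≡ σ⊑τ (length-⊑ τ⊑σ)

⊏-length : ∀ {σ τ} → σ ⊏ τ → length σ < length τ
⊏-length (σ⊑τ , σ≢τ) = ≰⇒> (σ≢τ ∘ ⊑-length-≡ σ⊑τ)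

⊑-comparable : ∀ {σ τ ρ} → σ ⊑ ρ → τ ⊑ ρ → length σ ≤ length τ → σ ⊑ τ
⊑-comparable {[]} {τ} _ _ _ = τ , refl
⊑-comparable {_ ∷ _} {[]} _ _ ()
⊑-comparable {k ∷ σ} {j ∷ τ} (r , refl) (r′ , eq) (s≤s σ≤τ) with ∷-injective eq
... | refl , eq′ with ⊑-comparable (r , refl) (r′ , eq′) σ≤τ
...   | s , refl = s , refl

successor-⊑ : ∀ {α τ ρ} k → α ⊏ τ → τ ⊑ ρ → (α ++ [ k ]) ⊑ ρ → (α ++ [ k ]) ⊑ τ
successor-⊑ {α} k α⊏τ τ⊑ρ αk⊑ρ =
  ⊑-comparable αk⊑ρ τ⊑ρ (≤-trans (≤-reflexive (trans (length-++ α) (+-comm (length α) 1))) (⊏-length α⊏τ))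

_⊑?_ : ∀ σ τ → Dec (σ ⊑ τ)
[] ⊑? τ = yes (τ , refl)
(k ∷ σ) ⊑? [] = no λ { (_ , ()) }
(k ∷ σ) ⊑? (j ∷ τ) with k ℕ.≟ j | σ ⊑? τ
... | yes refl | yes (r , refl) = yes (r , refl)
... | no k≢j | _ = no λ (_ , eq) → k≢j (proj₁ (∷-injective eq))
... | yes _ | no σ⋢τ = no λ (r , eq) → σ⋢τ (r , proj₂ (∷-injective eq))

_≟s_ : DecidableEquality Str
_≟s_ = ≡-dec ℕ._≟_

onlyOrOther : ∀ α (U : Tree) → ListAll.All (_≡ α) U ⊎ ∃ λ ρ → ρ ∈ U × ρ ≢ α
onlyOrOther α U with ListAll.all? (_≟s α) U
... | yes allα = inj₁ allα
... | no notAllα = inj₂ (find (¬All⇒Any¬ (_≟s α) U notAllα))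

nonempty-∈ : ∀ {A : Set} {xs : List A} → 0 < length xs → ∃ λ x → x ∈ xs
nonempty-∈ {xs = x ∷ _} _ = x , here refl

∈-concatMap-witness : ∀ {A B : Set} {f : A → List B} {xs y} → y ∈ concatMap f xs → ∃ λ x → x ∈ xs × y ∈ f x
∈-concatMap-witness {f = f} {xs} = find ∘ ∈-concatMap⁻ f {xs}

totalise : ∀ {A B : Set} {C : A → B → Set} → DecidableEquality A → (xs : List A) → B →
           (∀ {x} → x ∈ xs → Σ B (C x)) → Σ (A → B) λ f → ∀ {x} → x ∈ xs → C x (f x)
totalise {A} {B} {C} _≟_ xs default choose = choice , chosen
  where
  open DecMembership _≟_ using (_∈?_)
  choice : A → B
  choice x with x ∈? xs
  ... | yes x∈xs = proj₁ (choose x∈xs)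
  ... | no _ = default
  chosen : ∀ {x} → x ∈ xs → C x (choice x)
  chosen {x} x∈xs with x ∈? xs
  ... | yes x∈xs′ = proj₂ (choose x∈xs′)
  ... | no x∉xs = contradiction x∈xs x∉xs

length-filter-split : ∀ {A : Set} {P : A → Set} (P? : Decidable P) (xs : List A) →
  length xs ≡ length (filter P? xs) + length (filter (¬? ∘ P?) xs)
length-filter-split P? [] = refl
length-filter-split P? (x ∷ xs) with P? x
... | yes _ = cong suc (length-filter-split P? xs)
... | no _ = trans (cong suc (length-filter-split P? xs)) (sym (+-suc _ _))

Fin1-unique : (i : Fin 1) → i ≡ fzero
Fin1-unique fzero = refl

-- Recolouring, with one colour fewer, of items avoiding colour 0.
shiftDown : ∀ {b} → Fin (suc (suc b)) → Fin (suc b)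
shiftDown fzero = fzero
shiftDown (fsuc i) = i

shiftDown-inverse : ∀ {b} (j : Fin (suc (suc b))) → j ≢ fzero → fsuc (shiftDown j) ≡ j
shiftDown-inverse fzero j≢0 = contradiction refl j≢0
shiftDown-inverse (fsuc i) _ = refl

hasColour? : ∀ {A : Set} {c} (g : A → Fin c) (i : Fin c) → Decidable (λ x → g x ≡ i)
hasColour? g i x = g x Fin.≟ i

-- If the items of colour 0 are too few, the others are (b+1)·n many and carry
-- b+1 colours; otherwise colour 0 is the wanted colour.
pigeonhole : ∀ {A : Set} b n (g : A → Fin (suc b)) (xs : List A) → Unique xs → suc b * n ≤ length xs →
  ∃ λ i → Σ (List A) λ ys → ys ⊆ xs × Unique ys × n ≤ length ys × ListAll.All (λ y → g y ≡ i) ys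
pigeonhole zero n g xs xs! n≤xs =
  fzero , xs , ⊆-refl , xs! , subst (_≤ length xs) (+-identityʳ n) n≤xs ,
  ListAll.tabulate λ {x} _ → Fin1-unique (g x)
pigeonhole (suc b) n g xs xs! large with n ≤? length (filter (hasColour? g fzero) xs)
... | yes enough =
  fzero , filter (hasColour? g fzero) xs , filter-⊆ (hasColour? g fzero) xs ,
  Unique.filter⁺ (hasColour? g fzero) xs! , enough , all-filter (hasColour? g fzero) xs
... | no few with pigeonhole b n (shiftDown ∘ g) (filter (¬? ∘ hasColour? g fzero) xs)
                   (Unique.filter⁺ (¬? ∘ hasColour? g fzero) xs!) restLarge
  where
  restLarge : suc b * n ≤ length (filter (¬? ∘ hasColour? g fzero) xs)
  restLarge = +-cancelˡ-≤ n _ _ (≤-trans large (≤-trans (≤-reflexive (length-filter-split (hasColour? g fzero) xs))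
                (+-monoˡ-≤ _ (<⇒≤ (≰⇒> few)))))
...   | i , ys , ys⊆rest , ys! , n≤ys , ysColour =
  fsuc i , ys , ⊆-trans ys⊆rest (filter-⊆ (¬? ∘ hasColour? g fzero) xs) , ys! , n≤ys ,
  ListAll.tabulate recoloured
  where
  recoloured : ∀ {y} → y ∈ ys → g y ≡ fsuc i
  recoloured {y} y∈ys =
    trans (sym (shiftDown-inverse (g y) (proj₂ (∈-filter⁻ (¬? ∘ hasColour? g fzero) {xs = xs} (ys⊆rest y∈ys)))))
          (cong fsuc (ListAll.lookup ysColour y∈ys))

Branching : ℕ → Tree → Str → Set
Branching a T τ = Σ (List ℕ) λ ks → length ks ≥ a × Unique ks
  × ListAll.All (λ k → ∃ λ ρ′ → ρ′ ∈ T × (τ ++ [ k ]) ⊑ ρ′) ks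

IsTree-⊆ : ∀ {U V} → V ⊆ U → IsTree U → IsTree V
IsTree-⊆ V⊆U isTree ρ∈V τ∈V = isTree (V⊆U ρ∈V) (V⊆U τ∈V)

-- A nonempty tree whose elements all equal α is a-good from α for every a:
-- no string lies strictly between α and an element.
Good-root : ∀ {a α U} → (∃ λ ρ → ρ ∈ U) → ListAll.All (_≡ α) U → Good a α U
Good-root {a} {α} {U} nonempty allα = nonempty , above , noneBetween
  where
  above : ∀ {ρ} → ρ ∈ U → α ⊑ ρ
  above ρ∈U with ListAll.lookup allα ρ∈U
  ... | refl = ⊑-refl α
  noneBetween : ∀ τ ρ → ρ ∈ U → α ⊑ τ → τ ⊏ ρ → Branching a U τ
  noneBetween τ ρ ρ∈U α⊑τ (τ⊑ρ , τ≢ρ) with ListAll.lookup allα ρ∈U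
  ... | refl = contradiction (⊑-antisym τ⊑ρ α⊑τ) τ≢ρ

branch : Str → ℕ → Tree → Tree
branch α k U = filter ((α ++ [ k ]) ⊑?_) U

branch-⊆ : ∀ α k U → branch α k U ⊆ U
branch-⊆ α k U = filter-⊆ ((α ++ [ k ]) ⊑?_) U

Good-branch : ∀ {a α U} k → Good a α U → (∃ λ ρ → ρ ∈ U × (α ++ [ k ]) ⊑ ρ) → Good a (α ++ [ k ]) (branch α k U)
Good-branch {a} {α} {U} k (_ , _ , branching) (ρ , ρ∈U , αk⊑ρ) =
  (ρ , ∈-filter⁺ _⊑?αk ρ∈U αk⊑ρ) , (proj₂ ∘ ∈-filter⁻ _⊑?αk {xs = U}) , branching′
  where
  _⊑?αk : Decidable ((α ++ [ k ]) ⊑_)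
  _⊑?αk = (α ++ [ k ]) ⊑?_
  branching′ : ∀ τ ρ → ρ ∈ branch α k U → (α ++ [ k ]) ⊑ τ → τ ⊏ ρ → Branching a (branch α k U) τ
  branching′ τ ρ ρ∈ αk⊑τ τ⊏ρ
    with branching τ ρ (proj₁ (∈-filter⁻ _⊑?αk {xs = U} ρ∈)) (⊑-trans (⊑-++ α [ k ]) αk⊑τ) τ⊏ρ
  ... | ks , enough , ks! , successors = ks , enough , ks! , ListAll.map keep successors
    where
    keep : ∀ {j} → ∃ (λ ρ′ → ρ′ ∈ U × (τ ++ [ j ]) ⊑ ρ′) → ∃ λ ρ′ → ρ′ ∈ branch α k U × (τ ++ [ j ]) ⊑ ρ′
    keep {j} (ρ′ , ρ′∈U , τj⊑ρ′) =
      ρ′ , ∈-filter⁺ _⊑?αk ρ′∈U (⊑-trans αk⊑τ (⊑-trans (⊑-++ τ [ j ]) τj⊑ρ′)) , τj⊑ρ′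

-- Trees n-good from n distinct successors α ++ [ k ] of α glue to a tree
-- n-good from α: the successors provide the branching at α itself.
Good-glue : ∀ {n α} (ks : List ℕ) (V : ℕ → Tree) → Unique ks → n ≤ length ks → n > 0 →
            (∀ {k} → k ∈ ks → Good n (α ++ [ k ]) (V k)) → Good n α (concatMap V ks)
Good-glue {n} {α} ks V ks! n≤ks n>0 good = nonempty , above , branching
  where
  inGlue : ∀ {k ρ} → k ∈ ks → ρ ∈ V k → ρ ∈ concatMap V ks
  inGlue k∈ks ρ∈Vk = ∈-concatMap⁺ V (lose k∈ks ρ∈Vk)
  successors : ListAll.All (λ k → ∃ λ ρ → ρ ∈ concatMap V ks × (α ++ [ k ]) ⊑ ρ) ks
  successors = ListAll.tabulate λ k∈ks →
    let (ρ , ρ∈Vk) = proj₁ (good k∈ks) in ρ , inGlue k∈ks ρ∈Vk , proj₁ (proj₂ (good k∈ks)) ρ∈Vk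
  nonempty : ∃ λ ρ → ρ ∈ concatMap V ks
  nonempty = let (ρ , ρ∈ , _) = ListAll.lookup successors (proj₂ (nonempty-∈ (≤-trans n>0 n≤ks))) in ρ , ρ∈
  above : ∀ {ρ} → ρ ∈ concatMap V ks → α ⊑ ρ
  above ρ∈ = let (k , k∈ks , ρ∈Vk) = ∈-concatMap-witness ρ∈ in
    ⊑-trans (⊑-++ α [ k ]) (proj₁ (proj₂ (good k∈ks)) ρ∈Vk)
  branching : ∀ τ ρ → ρ ∈ concatMap V ks → α ⊑ τ → τ ⊏ ρ → Branching n (concatMap V ks) τ
  branching τ ρ ρ∈ α⊑τ τ⊏ρ with τ ≟s α | ∈-concatMap-witness ρ∈
  ... | yes refl | _ = ks , n≤ks , ks! , successors
  ... | no τ≢α | k , k∈ks , ρ∈Vk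
    with proj₂ (proj₂ (good k∈ks)) τ ρ ρ∈Vk
           (successor-⊑ k (α⊑τ , ≢-sym τ≢α) (proj₁ τ⊏ρ) (proj₁ (proj₂ (good k∈ks)) ρ∈Vk)) τ⊏ρ
  ... | ks′ , enough , ks′! , successors′ =
    ks′ , enough , ks′! , ListAll.map (λ (ρ′ , ρ′∈ , τj⊑ρ′) → ρ′ , inGlue k∈ks ρ′∈ , τj⊑ρ′) successors′

HeightBelow : ℕ → Str → Tree → Set
HeightBelow d α U = ∀ {ρ} → ρ ∈ U → length ρ ≤ length α + d

heightBound : ∀ α U → ∃ λ d → HeightBelow d α U
heightBound α [] = 0 , λ ()
heightBound α (ρ ∷ U) with heightBound α U
... | d , bound = length ρ ⊔ d , λ
  { (here refl) → ≤-trans (m≤m⊔n (length ρ) d) (m≤n+m _ (length α))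
  ; (there ρ′∈U) → ≤-trans (bound ρ′∈U) (+-monoʳ-≤ (length α) (m≤n⊔m (length ρ) d)) }

HeightBelow-branch : ∀ {d α U} k → HeightBelow (suc d) α U → HeightBelow d (α ++ [ k ]) (branch α k U)
HeightBelow-branch {d} {α} {U} k height ρ∈ =
  ≤-trans (height (branch-⊆ α k U ρ∈))
    (≤-reflexive (trans (+-suc (length α) d) (cong (_+ d) (sym (trans (length-++ α) (+-comm (length α) 1))))))

module Colouring (b n N : ℕ) (n>0 : n > 0) (N≥ : suc b * n ≤ N) (colour : Str → Fin (suc b)) where

  MonoSubtree : Str → Tree → Fin (suc b) → Tree → Set
  MonoSubtree α U i V = V ⊆ U × Good n α V × (∀ {ρ} → ρ ∈ V → colour ρ ≡ i)

  MonoSubtreeOf : Str → Tree → Set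
  MonoSubtreeOf α U = Σ (Fin (suc b) × Tree) λ (i , V) → MonoSubtree α U i V

  -- If N distinct successors of α carry monochromatic subtrees of their
  -- branches, n of them share a colour, and their subtrees glue.
  glueBranches : ∀ α U (ks : List ℕ) → Unique ks → N ≤ length ks →
                 (∀ {k} → k ∈ ks → MonoSubtreeOf (α ++ [ k ]) (branch α k U)) → MonoSubtreeOf α U
  glueBranches α U ks ks! N≤ks sub with totalise ℕ._≟_ ks (fzero , []) sub
  ... | choice , chosen with pigeonhole b n (proj₁ ∘ choice) ks ks! (≤-trans N≥ N≤ks)
  ... | i , ks′ , ks′⊆ks , ks′! , n≤ks′ , sameColour =
    (i , concatMap W ks′) , glued⊆U , Good-glue ks′ W ks′! n≤ks′ n>0 (proj₁ ∘ proj₂ ∘ chosen ∘ ks′⊆ks) , gluedColour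
    where
    W : ℕ → Tree
    W = proj₂ ∘ choice
    glued⊆U : concatMap W ks′ ⊆ U
    glued⊆U ρ∈ = let (k , k∈ks′ , ρ∈Wk) = ∈-concatMap-witness ρ∈ in
      branch-⊆ α k U (proj₁ (chosen (ks′⊆ks k∈ks′)) ρ∈Wk)
    gluedColour : ∀ {ρ} → ρ ∈ concatMap W ks′ → colour ρ ≡ i
    gluedColour ρ∈ = let (k , k∈ks′ , ρ∈Wk) = ∈-concatMap-witness ρ∈ in
      trans (proj₂ (proj₂ (chosen (ks′⊆ks k∈ks′))) ρ∈Wk) (ListAll.lookup sameColour k∈ks′)

  -- Induction on the height; a tree consisting of α alone is its own subtree.
  monoSubtree-height : ∀ d α U → Good N α U → HeightBelow d α U → MonoSubtreeOf α U
  monoSubtree-height d α U good height with onlyOrOther α U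
  ... | inj₁ allα =
    (colour α , U) , ⊆-refl , Good-root (proj₁ good) allα , λ ρ∈U → cong colour (ListAll.lookup allα ρ∈U)
  monoSubtree-height zero α U (_ , above , _) height | inj₂ (ρ , ρ∈U , ρ≢α) =
    contradiction (sym (⊑-length-≡ (above ρ∈U) (subst (length ρ ≤_) (+-identityʳ (length α)) (height ρ∈U)))) ρ≢α
  monoSubtree-height (suc d) α U good@(_ , above , branching) height | inj₂ (ρ , ρ∈U , ρ≢α)
    with branching α ρ ρ∈U (⊑-refl α) (above ρ∈U , ≢-sym ρ≢α)
  ... | ks , N≤ks , ks! , successors = glueBranches α U ks ks! N≤ks λ {k} k∈ks →
    monoSubtree-height d (α ++ [ k ]) (branch α k U)
      (Good-branch k good (ListAll.lookup successors k∈ks)) (HeightBelow-branch k height)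

  monoSubtree : ∀ α U → Good N α U → MonoSubtreeOf α U
  monoSubtree α U good = let (d , height) = heightBound α U in monoSubtree-height d α U good height

record Agree (S S′ : System) (pre : List Str) : Set where
  constructor agree
  field agrees : ∀ r → S (pre ++ r) ≡ S′ (pre ++ r)

Agree-here : ∀ {S S′ pre} → Agree S S′ pre → S pre ≡ S′ pre
Agree-here {S} {S′} {pre} (agree eq) = subst (λ q → S q ≡ S′ q) (++-identityʳ pre) (eq [])

Agree-step : ∀ {S S′ pre} → Agree S S′ pre → ∀ σ → Agree S S′ (pre ++ [ σ ])
Agree-step {S} {S′} {pre} (agree eq) σ =
  agree λ r → subst (λ q → S q ≡ S′ q) (sym (++-assoc pre [ σ ] r)) (eq (σ ∷ r))

Agree-sym : ∀ {S S′ pre} → Agree S S′ pre → Agree S′ S pre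
Agree-sym (agree eq) = agree λ r → sym (eq r)

ElemFrom-agree : ∀ {S S′ pre} → Agree S S′ pre → ∀ m σs → ElemFrom S pre m σs → ElemFrom S′ pre m σs
ElemFrom-agree ag zero [] tt = tt
ElemFrom-agree ag (suc m) (σ ∷ σs) (σ∈ , rest) =
  subst (σ ∈_) (Agree-here ag) σ∈ , ElemFrom-agree (Agree-step ag σ) m σs rest

TreesFrom-agree : ∀ {S S′ pre} → Agree S S′ pre → ∀ m → TreesFrom S pre m → TreesFrom S′ pre m
TreesFrom-agree ag zero tt = tt
TreesFrom-agree ag (suc m) (isTree , trees) =
  subst IsTree (Agree-here ag) isTree ,
  λ {σ} σ∈ → TreesFrom-agree (Agree-step ag σ) m (trees (subst (σ ∈_) (sym (Agree-here ag)) σ∈))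

GoodFrom-agree : ∀ {S S′ pre} → Agree S S′ pre → ∀ m ns αs → GoodFromAux S pre m ns αs → GoodFromAux S′ pre m ns αs
GoodFrom-agree ag zero [] [] tt = tt
GoodFrom-agree ag (suc m) (n ∷ ns) (α ∷ αs) (good , goods) =
  subst (Good n α) (Agree-here ag) good ,
  λ {σ} σ∈ → GoodFrom-agree (Agree-step ag σ) m ns αs (goods (subst (σ ∈_) (sym (Agree-here ag)) σ∈))

-- Grafting: the system whose tree at pre is V and which continues as S ρ
-- above pre ++ [ ρ ].

graftAt : Tree → (Str → System) → List Str → List Str → Tree
graftAt V S q [] = V
graftAt V S q (ρ ∷ _) = S ρ q

graft : List Str → Tree → (Str → System) → System
graft pre V S q = graftAt V S q (drop (length pre) q)

drop-++ : ∀ (pre r : List Str) → drop (length pre) (pre ++ r) ≡ r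
drop-++ [] r = refl
drop-++ (_ ∷ pre) r = drop-++ pre r

graft-root : ∀ pre V S → graft pre V S pre ≡ V
graft-root pre V S =
  cong (graftAt V S pre) (trans (cong (drop (length pre)) (sym (++-identityʳ pre))) (drop-++ pre []))

graft-branch : ∀ pre V S ρ → Agree (graft pre V S) (S ρ) (pre ++ [ ρ ])
graft-branch pre V S ρ = agree λ r →
  cong (graftAt V S _) (trans (cong (drop (length pre)) (++-assoc pre [ ρ ] r)) (drop-++ pre (ρ ∷ r)))

GoodSubsystem : (m : ℕ) → List Str → System → Vec ℕ m → Vec Str m → (Vec Str m → Set) → System → Set
GoodSubsystem m pre T ns αs Q S = TreesFrom S pre m × (∀ σs → ElemFrom S pre m σs → ElemFrom T pre m σs)
  × GoodFromAux S pre m ns αs × (∀ σs → ElemFrom S pre m σs → Q σs)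

graft-GoodSubsystem : ∀ {m pre T n ns α αs Q V S} → IsTree (T pre) → V ⊆ T pre → Good n α V →
  (∀ {ρ} → ρ ∈ V → GoodSubsystem m (pre ++ [ ρ ]) T ns αs (Q ∘ (ρ ∷_)) (S ρ)) →
  GoodSubsystem (suc m) pre T (n ∷ ns) (α ∷ αs) Q (graft pre V S)
graft-GoodSubsystem {m} {pre} {T} {n} {ns} {α} {αs} {Q} {V} {S} isTree V⊆ goodV sub =
  (subst IsTree (sym (graft-root pre V S)) (IsTree-⊆ V⊆ isTree) ,
   λ {σ} σ∈ → TreesFrom-agree (Agree-sym (graft-branch pre V S σ)) m (proj₁ (sub (toV σ∈)))) ,
  elements ,
  (subst (Good n α) (sym (graft-root pre V S)) goodV ,
   λ {σ} σ∈ → GoodFrom-agree (Agree-sym (graft-branch pre V S σ)) m ns αs (proj₁ (proj₂ (proj₂ (sub (toV σ∈)))))) ,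
  inQ
  where
  toV : ∀ {σ} → σ ∈ graft pre V S pre → σ ∈ V
  toV = subst (_ ∈_) (graft-root pre V S)
  elements : ∀ σs → ElemFrom (graft pre V S) pre (suc m) σs → ElemFrom T pre (suc m) σs
  elements (σ ∷ σs) (σ∈ , rest) =
    V⊆ (toV σ∈) , proj₁ (proj₂ (sub (toV σ∈))) σs (ElemFrom-agree (graft-branch pre V S σ) m σs rest)
  inQ : ∀ σs → ElemFrom (graft pre V S) pre (suc m) σs → Q σs
  inQ (σ ∷ σs) (σ∈ , rest) =
    proj₂ (proj₂ (proj₂ (sub (toV σ∈)))) σs (ElemFrom-agree (graft-branch pre V S σ) m σs rest)

module _ (b : ℕ) (f : ℕ → ℕ) (f-large : ∀ k → suc b * k ≤ f k) where

  MonoSubsystem : (m : ℕ) → List Str → System → Vec ℕ m → Vec Str m → (Fin (suc b) → Vec Str m → Set) → Set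
  MonoSubsystem m pre T ns αs Q = Σ (Fin (suc b) × System) λ (i , S) → GoodSubsystem m pre T ns αs (Q i) S

  -- Induction step: the top tree is coloured by the colours of the subsystems
  -- above its elements, and a monochromatic subtree of it is selected.
  monoSubsystem-step : ∀ m pre n ns α αs T Q → n > 0 → IsTree (T pre) → Good (f n) α (T pre) →
    (∀ {ρ} → ρ ∈ T pre → MonoSubsystem m (pre ++ [ ρ ]) T ns αs (λ i → Q i ∘ (ρ ∷_))) →
    MonoSubsystem (suc m) pre T (n ∷ ns) (α ∷ αs) Q
  monoSubsystem-step m pre n ns α αs T Q n>0 isTree good above
    with totalise _≟s_ (T pre) (fzero , T) above
  ... | choice , chosen with Colouring.monoSubtree b n (f n) n>0 (f-large n) (proj₁ ∘ choice) α (T pre) good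
  ... | (i , V) , V⊆ , goodV , colourV =
    (i , graft pre V (proj₂ ∘ choice)) , graft-GoodSubsystem isTree V⊆ goodV aboveV
    where
    aboveV : ∀ {ρ} → ρ ∈ V → GoodSubsystem m (pre ++ [ ρ ]) T ns αs (Q i ∘ (ρ ∷_)) (proj₂ (choice ρ))
    aboveV {ρ} ρ∈V = subst (λ j → GoodSubsystem m (pre ++ [ ρ ]) T ns αs (Q j ∘ (ρ ∷_)) (proj₂ (choice ρ)))
                           (colourV ρ∈V) (chosen (V⊆ ρ∈V))

  monoSubsystem : ∀ m pre (ns : Vec ℕ m) αs T → All (_> 0) ns → TreesFrom T pre m →
    GoodFromAux T pre m (map f ns) αs → (Q : Fin (suc b) → Vec Str m → Set) →
    (∀ σs → ElemFrom T pre m σs → ∃ λ i → Q i σs) → MonoSubsystem m pre T ns αs Q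
  monoSubsystem zero pre [] [] T _ _ _ Q cover =
    (proj₁ (cover [] tt) , T) , tt , (λ _ e → e) , tt , λ { [] tt → proj₂ (cover [] tt) }
  monoSubsystem (suc m) pre (n ∷ ns) (α ∷ αs) T (n>0 ∷ ns>0) (isTree , trees) (good , goods) Q cover =
    monoSubsystem-step m pre n ns α αs T Q n>0 isTree good λ {ρ} ρ∈ →
      monoSubsystem m (pre ++ [ ρ ]) ns αs T ns>0 (trees ρ∈) (goods ρ∈)
        (λ i → Q i ∘ (ρ ∷_)) (λ σs e → cover (ρ ∷ σs) (ρ∈ , e))

-- a ≤ 2^(a-1), so a 2^(a-1)·n⃗-good system is (a·n⃗)-good.
suc≤2^ : ∀ b → suc b ≤ 2 ^ b
suc≤2^ zero = s≤s z≤n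
suc≤2^ (suc b) = ≤-trans (+-mono-≤ (m^n>0 2 b) (suc≤2^ b)) (≤-reflexive (cong (2 ^ b +_) (sym (+-identityʳ (2 ^ b)))))

lemma3p6 : (a x : ℕ) → a ≥ 1 → (n : Vec ℕ (suc x)) → All (λ k → k > 0) n
    → (T : System) → IsSystemOfTrees x T → (α : Vec Str (suc x))
    → GoodSys x T (map (λ k → 2 ^ (a ∸ 1) * k) n) α
    → (P : Fin a → Vec Str (suc x) → Set)
    → (∀ v → Element x T v → ∃ λ i → P i v)
    → ∃ λ i → Σ System λ S → Subsystem x S T × GoodSys x S n α × SystemFor x S (P i)
lemma3p6 (suc b) x _ n n>0 T trees α good P cover
  with monoSubsystem b (λ k → 2 ^ b * k) (λ k → *-monoˡ-≤ k (suc≤2^ b)) (suc x) [] n α T n>0 trees good P cover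
... | (i , S) , treesS , S⊆T , goodS , inP = i , S , (treesS , S⊆T) , goodS , inP
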